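{- If $n,t,l,s,\alpha$ are non-negative integers with $2\leq l<t<n$, $s\leq\phi(t,l)$ and $s\leq\alpha\leq (n-t)s$, then $\binom{n}{l}-s-\alpha(l-1)\in S(n,l)$.
   Context: For integers $l<t$, $\phi(t,l)$ is the maximum size of a family $\mathcal F\subseteq\binom{[t]}{l}$ that is pairwise shadow-disjoint, i.e. $|A\cap B|\leq l-2$ for all distinct $A,B\in\mathcal F$. $S(n,l)$ is the set of sizes of maximal antichains $\mathcal A\subseteq\binom{[n]}{l}\cup\binom{[n]}{l+1}$ in the Boolean lattice $B_n$ (maximal: no subset of $[n]$ can be added keeping the antichain property); $\binom{[m]}{j}$ is the family of $j$-subsets of $[m]$. -}

module Defs where

open import Data.Nat using (ℕ; _≤_; _∸_; _+_; _*_)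
open import Data.Integer as ℤ using (ℤ; +_)
open import Data.Fin.Subset using (Subset; _⊆_; _∩_; ∣_∣)
open import Data.List using (List; length)
open import Data.List.Membership.Propositional using (_∈_; _∉_)
open import Data.List.Relation.Unary.All using (All)
open import Data.List.Relation.Unary.Unique.Propositional using (Unique)
open import Data.Product using (Σ; ∃; _×_; _,_)
open import Data.Sum using (_⊎_)
open import Relation.Binary.PropositionalEquality using (_≡_; _≢_)

-- A family of subsets of [n] is a duplicate-free list of subsets; its size is its length.
Family : ℕ → Set
Family n = List (Subset n)

ShadowDisjoint : (t l : ℕ) → Family t → Set
ShadowDisjoint t l F =
  Unique F × All (λ A → ∣ A ∣ ≡ l) F ×
  (∀ {A B} → A ∈ F → B ∈ F → A ≢ B → ∣ A ∩ B ∣ ≤ l ∸ 2)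

IsPhi : (t l m : ℕ) → Set
IsPhi t l m =
  (Σ (Family t) λ F → ShadowDisjoint t l F × length F ≡ m) ×
  (∀ (F : Family t) → ShadowDisjoint t l F → length F ≤ m)

IsMaximalAntichainLevels : (n l : ℕ) → Family n → Set
IsMaximalAntichainLevels n l 𝒜 =
  Unique 𝒜 ×
  All (λ A → ∣ A ∣ ≡ l ⊎ ∣ A ∣ ≡ l + 1) 𝒜 ×
  (∀ {A B} → A ∈ 𝒜 → B ∈ 𝒜 → A ⊆ B → A ≡ B) ×
  (∀ (X : Subset n) → X ∉ 𝒜 → ∃ λ A → A ∈ 𝒜 × (A ⊆ X ⊎ X ⊆ A))

-- k ∈ S(n,l)  (sizes taken as integers so no truncated subtraction is involved)
InS : (n l : ℕ) → ℤ → Set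
InS n l k = Σ (Family n) λ 𝒜 → IsMaximalAntichainLevels n l 𝒜 × (+ length 𝒜) ≡ k

-- Split [n] into [t] and n - t new points. Pick s members A of a shadow-disjoint family in
-- binom([t], l) and α distinct pairs (x, A), x a new point, using every picked A at least once
-- (possible as s ≤ α ≤ (n - t) s), and raise each pair to the (l+1)-set A ∪ {x}. Since the picked
-- sets meet pairwise in at most l - 2 points, the l-shadow of the raised sets consists of the s
-- sets A and αl further sets (A - a) ∪ {x}, all distinct. Removing this shadow from binom([n], l)
-- and adding the α raised sets leaves an antichain of size C(n,l) - s - αl + α. It is maximal:
-- every l-set lies in it or below a raised set, and every (l+1)-set that is not raised contains
-- an l-set outside the shadow.
module Submission where

module SubsetProperties where

  open import Data.Nat using (ℕ; zero; suc; _+_; _≤_; _<_; z≤n; s≤s; _≤?_)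
  open import Data.Nat.Properties
  open import Data.Fin as Fin using (Fin; zero; suc)
  open import Data.Vec using ([]; _∷_; _++_; here; there)
  open import Data.Fin.Subset
  open import Data.Fin.Subset.Properties
  open import Data.Product using (∃; _×_; _,_)
  open import Data.Sum using (_⊎_; inj₁; inj₂)
  open import Relation.Nullary using (yes; no; contradiction)
  open import Relation.Binary.PropositionalEquality
  open import Function using (_∘′_)

  private variable m n : ℕ

  ∣p++q∣≡∣p∣+∣q∣ : (p : Subset m) (q : Subset n) → ∣ p ++ q ∣ ≡ ∣ p ∣ + ∣ q ∣
  ∣p++q∣≡∣p∣+∣q∣ []            q = refl
  ∣p++q∣≡∣p∣+∣q∣ (inside  ∷ p) q = cong suc (∣p++q∣≡∣p∣+∣q∣ p q)
  ∣p++q∣≡∣p∣+∣q∣ (outside ∷ p) q = ∣p++q∣≡∣p∣+∣q∣ p q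

  ∣p++⊥∣≡∣p∣ : (p : Subset m) → ∣ p ++ ⊥ {n} ∣ ≡ ∣ p ∣
  ∣p++⊥∣≡∣p∣ {n = n} p = trans (∣p++q∣≡∣p∣+∣q∣ p ⊥) (trans (cong (∣ p ∣ +_) (∣⊥∣≡0 n)) (+-identityʳ _))

  ∣p++⁅x⁆∣≡1+∣p∣ : (p : Subset m) (x : Fin n) → ∣ p ++ ⁅ x ⁆ ∣ ≡ suc ∣ p ∣
  ∣p++⁅x⁆∣≡1+∣p∣ p x = trans (∣p++q∣≡∣p∣+∣q∣ p ⁅ x ⁆) (trans (cong (∣ p ∣ +_) (∣⁅x⁆∣≡1 x)) (+-comm _ 1))

  ++⁺-⊆ : {p p′ : Subset m} {q q′ : Subset n} → p ⊆ p′ → q ⊆ q′ → p ++ q ⊆ p′ ++ q′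
  ++⁺-⊆ {p = []}    {[]}     _    q⊆q′ x∈ = q⊆q′ x∈
  ++⁺-⊆ {p = _ ∷ _} {_ ∷ _} p⊆p′ q⊆q′ here with p⊆p′ here
  ... | here = here
  ++⁺-⊆ {p = _ ∷ _} {_ ∷ _} p⊆p′ q⊆q′ (there x∈) = there (++⁺-⊆ (drop-∷-⊆ p⊆p′) q⊆q′ x∈)

  ++⁻-⊆ : {p p′ : Subset m} {q q′ : Subset n} → p ++ q ⊆ p′ ++ q′ → p ⊆ p′ × q ⊆ q′
  ++⁻-⊆ {p = []} {[]} pq⊆ = (λ ()) , pq⊆
  ++⁻-⊆ {p = inside ∷ p} {_ ∷ p′} pq⊆ with pq⊆ here | ++⁻-⊆ {p = p} {p′} (drop-∷-⊆ pq⊆)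
  ... | here | p⊆p′ , q⊆q′ = in⊆in p⊆p′ , q⊆q′
  ++⁻-⊆ {p = outside ∷ p} {_ ∷ p′} pq⊆ with ++⁻-⊆ {p = p} {p′} (drop-∷-⊆ pq⊆)
  ... | p⊆p′ , q⊆q′ = out⊆ p⊆p′ , q⊆q′

  p⊆q∧∣q∣≤∣p∣⇒p≡q : {p q : Subset n} → p ⊆ q → ∣ q ∣ ≤ ∣ p ∣ → p ≡ q
  p⊆q∧∣q∣≤∣p∣⇒p≡q {p = []}          {[]}          _   _ = refl
  p⊆q∧∣q∣≤∣p∣⇒p≡q {p = inside  ∷ p} {inside  ∷ q} p⊆q (s≤s ∣q∣≤∣p∣) =
    cong (inside ∷_) (p⊆q∧∣q∣≤∣p∣⇒p≡q (drop-∷-⊆ p⊆q) ∣q∣≤∣p∣)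
  p⊆q∧∣q∣≤∣p∣⇒p≡q {p = outside ∷ p} {outside ∷ q} p⊆q ∣q∣≤∣p∣ =
    cong (outside ∷_) (p⊆q∧∣q∣≤∣p∣⇒p≡q (drop-∷-⊆ p⊆q) ∣q∣≤∣p∣)
  p⊆q∧∣q∣≤∣p∣⇒p≡q {p = inside  ∷ p} {outside ∷ q} p⊆q _ with p⊆q here
  ... | ()
  p⊆q∧∣q∣≤∣p∣⇒p≡q {p = outside ∷ p} {inside  ∷ q} p⊆q ∣q∣≤∣p∣ =
    contradiction ∣q∣≤∣p∣ (<⇒≱ (s≤s (p⊆q⇒∣p∣≤∣q∣ (drop-∷-⊆ p⊆q))))

  ∣p∣≡1+k⇒Nonempty : {p : Subset n} {k : ℕ} → ∣ p ∣ ≡ suc k → Nonempty p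
  ∣p∣≡1+k⇒Nonempty {p = inside  ∷ p} _ = zero , here
  ∣p∣≡1+k⇒Nonempty {p = outside ∷ p} ∣p∣≡1+k =
    let x , x∈p = ∣p∣≡1+k⇒Nonempty ∣p∣≡1+k in suc x , there x∈p

  p⊆q∧∣p∣<∣q∣⇒∃x∈q∖p : {p q : Subset n} → p ⊆ q → ∣ p ∣ < ∣ q ∣ → ∃ λ x → x ∈ q × x ∉ p
  p⊆q∧∣p∣<∣q∣⇒∃x∈q∖p {p = outside ∷ p} {inside ∷ q} _ _ = zero , here , λ ()
  p⊆q∧∣p∣<∣q∣⇒∃x∈q∖p {p = inside ∷ p} {inside ∷ q} p⊆q (s≤s ∣p∣<∣q∣) =
    let x , x∈q , x∉p = p⊆q∧∣p∣<∣q∣⇒∃x∈q∖p (drop-∷-⊆ p⊆q) ∣p∣<∣q∣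
    in suc x , there x∈q , x∉p ∘′ drop-there
  p⊆q∧∣p∣<∣q∣⇒∃x∈q∖p {p = outside ∷ p} {outside ∷ q} p⊆q ∣p∣<∣q∣ =
    let x , x∈q , x∉p = p⊆q∧∣p∣<∣q∣⇒∃x∈q∖p (drop-∷-⊆ p⊆q) ∣p∣<∣q∣
    in suc x , there x∈q , x∉p ∘′ drop-there
  p⊆q∧∣p∣<∣q∣⇒∃x∈q∖p {p = inside ∷ p} {outside ∷ q} p⊆q _ with p⊆q here
  ... | ()

  x∈p⇒suc∣p-x∣≡∣p∣ : {x : Fin n} {p : Subset n} → x ∈ p → suc ∣ p - x ∣ ≡ ∣ p ∣
  x∈p⇒suc∣p-x∣≡∣p∣ {p = inside ∷ p} here = cong (suc ∘′ ∣_∣) (p─⊥≡p p)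
  x∈p⇒suc∣p-x∣≡∣p∣ {p = inside  ∷ p} (there x∈p) = cong suc (x∈p⇒suc∣p-x∣≡∣p∣ x∈p)
  x∈p⇒suc∣p-x∣≡∣p∣ {p = outside ∷ p} (there x∈p) = x∈p⇒suc∣p-x∣≡∣p∣ x∈p

  x∈p∧∣p∣≡1+k⇒∣p-x∣≡k : {x : Fin n} {p : Subset n} {k : ℕ} → x ∈ p → ∣ p ∣ ≡ suc k → ∣ p - x ∣ ≡ k
  x∈p∧∣p∣≡1+k⇒∣p-x∣≡k x∈p ∣p∣≡1+k = suc-injective (trans (x∈p⇒suc∣p-x∣≡∣p∣ x∈p) ∣p∣≡1+k)

  x∉p-x : (p : Subset n) (x : Fin n) → x ∉ p - x
  x∉p-x (_ ∷ p) zero    ()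
  x∉p-x (_ ∷ p) (suc x) (there x∈p-x) = x∉p-x p x x∈p-x

  p-x≡p-y⇒x≡y : {x y : Fin n} {p : Subset n} → x ∈ p → p - x ≡ p - y → x ≡ y
  p-x≡p-y⇒x≡y {x = x} {y} {p} x∈p p-x≡p-y with x Fin.≟ y
  ... | yes x≡y = x≡y
  ... | no  x≢y = contradiction (subst (x ∈_) (sym p-x≡p-y) (x∈p∧x≢y⇒x∈p-y x∈p x≢y)) (x∉p-x p x)

  p⊆q∧suc∣p∣≡∣q∣⇒p≡q-x : {p q : Subset n} → p ⊆ q → suc ∣ p ∣ ≡ ∣ q ∣ → ∃ λ x → x ∈ q × p ≡ q - x
  p⊆q∧suc∣p∣≡∣q∣⇒p≡q-x {p = p} {q} p⊆q ∣q∣≡ with p⊆q∧∣p∣<∣q∣⇒∃x∈q∖p p⊆q (≤-reflexive ∣q∣≡)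
  ... | x , x∈q , x∉p = x , x∈q , p⊆q∧∣q∣≤∣p∣⇒p≡q p⊆q-x (≤-reflexive (x∈p∧∣p∣≡1+k⇒∣p-x∣≡k x∈q (sym ∣q∣≡)))
    where
    p⊆q-x : p ⊆ q - x
    p⊆q-x y∈p = x∈p∧x≢y⇒x∈p-y (p⊆q y∈p) λ { refl → x∉p y∈p }

  ∃⊇-of-size : (p : Subset n) (k : ℕ) → ∣ p ∣ ≤ k → k ≤ n → ∃ λ q → p ⊆ q × ∣ q ∣ ≡ k
  ∃⊇-of-size [] zero _ _ = [] , ⊆-refl , refl
  ∃⊇-of-size (inside ∷ p) (suc k) (s≤s ∣p∣≤k) (s≤s k≤n) =
    let q , p⊆q , ∣q∣≡k = ∃⊇-of-size p k ∣p∣≤k k≤n in inside ∷ q , in⊆in p⊆q , cong suc ∣q∣≡k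
  ∃⊇-of-size {suc n} (outside ∷ p) k ∣p∣≤k k≤1+n with k ≤? n
  ... | yes k≤n = let q , p⊆q , ∣q∣≡k = ∃⊇-of-size p k ∣p∣≤k k≤n in outside ∷ q , out⊆ p⊆q , ∣q∣≡k
  ... | no  k≰n = let q , p⊆q , ∣q∣≡n = ∃⊇-of-size p n (∣p∣≤n p) ≤-refl
                  in inside ∷ q , out⊆ p⊆q , trans (cong suc ∣q∣≡n) (≤-antisym (≰⇒> k≰n) k≤1+n)

  ∃⊆-of-size : (p : Subset n) (k : ℕ) → k ≤ ∣ p ∣ → ∃ λ q → q ⊆ p × ∣ q ∣ ≡ k
  ∃⊆-of-size [] zero _ = [] , ⊆-refl , refl
  ∃⊆-of-size (outside ∷ p) k k≤∣p∣ =
    let q , q⊆p , ∣q∣≡k = ∃⊆-of-size p k k≤∣p∣ in outside ∷ q , out⊆ q⊆p , ∣q∣≡k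
  ∃⊆-of-size {suc n} (inside ∷ p) zero _ = ⊥ , ⊥⊆ , ∣⊥∣≡0 (suc n)
  ∃⊆-of-size (inside ∷ p) (suc k) (s≤s k≤∣p∣) =
    let q , q⊆p , ∣q∣≡k = ∃⊆-of-size p k k≤∣p∣ in inside ∷ q , in⊆in q⊆p , cong suc ∣q∣≡k

  x∈p⇒⁅x⁆⊆p : {x : Fin n} {p : Subset n} → x ∈ p → ⁅ x ⁆ ⊆ p
  x∈p⇒⁅x⁆⊆p {x = x} x∈p y∈⁅x⁆ = subst (_∈ _) (sym (x∈⁅y⁆⇒x≡y x y∈⁅x⁆)) x∈p

  ⁅⁆-injective : {x y : Fin n} → ⁅ x ⁆ ≡ ⁅ y ⁆ → x ≡ y
  ⁅⁆-injective {x = x} {y} ⁅x⁆≡⁅y⁆ = x∈⁅y⁆⇒x≡y y (subst (x ∈_) ⁅x⁆≡⁅y⁆ (x∈⁅x⁆ x))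

  ⊥≢⁅x⁆ : {x : Fin n} → ⊥ ≢ ⁅ x ⁆
  ⊥≢⁅x⁆ {n} {x} ⊥≡⁅x⁆ with trans (sym (∣⊥∣≡0 n)) (trans (cong ∣_∣ ⊥≡⁅x⁆) (∣⁅x⁆∣≡1 x))
  ... | ()

  ∣p∣≡0⇒p≡⊥ : {p : Subset n} → ∣ p ∣ ≡ 0 → p ≡ ⊥
  ∣p∣≡0⇒p≡⊥ ∣p∣≡0 = sym (p⊆q∧∣q∣≤∣p∣⇒p≡q ⊥⊆ (≤-trans (≤-reflexive ∣p∣≡0) z≤n))

  ∣p∣≡1⇒p≡⁅x⁆ : {p : Subset n} → ∣ p ∣ ≡ 1 → ∃ λ x → p ≡ ⁅ x ⁆
  ∣p∣≡1⇒p≡⁅x⁆ ∣p∣≡1 with ∣p∣≡1+k⇒Nonempty ∣p∣≡1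
  ... | x , x∈p = x , sym (p⊆q∧∣q∣≤∣p∣⇒p≡q (x∈p⇒⁅x⁆⊆p x∈p)
                            (≤-reflexive (trans ∣p∣≡1 (sym (∣⁅x⁆∣≡1 x)))))

  p⊆⁅x⁆⇒p≡⊥⊎p≡⁅x⁆ : {x : Fin n} {p : Subset n} → p ⊆ ⁅ x ⁆ → p ≡ ⊥ ⊎ p ≡ ⁅ x ⁆
  p⊆⁅x⁆⇒p≡⊥⊎p≡⁅x⁆ {x = x} {p} p⊆⁅x⁆ with ∣ p ∣ in ∣p∣≡ | p⊆q⇒∣p∣≤∣q∣ p⊆⁅x⁆
  ... | 0 | _ = inj₁ (∣p∣≡0⇒p≡⊥ ∣p∣≡)
  ... | 1 | _ = inj₂ (p⊆q∧∣q∣≤∣p∣⇒p≡q p⊆⁅x⁆ (≤-reflexive (trans (∣⁅x⁆∣≡1 x) (sym ∣p∣≡))))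
  ... | suc (suc _) | ∣p∣≤1 = contradiction (≤-trans ∣p∣≤1 (≤-reflexive (∣⁅x⁆∣≡1 x))) λ { (s≤s ()) }

module ListProperties where

  open import Data.Nat using (ℕ; suc; _+_; _*_; _≤_; z≤n; s≤s)
  open import Data.Nat.Properties using (≤-trans; +-suc)
  open import Data.List using (List; []; _∷_; _++_; map; length; filter; take; concatMap; cartesianProduct)
  open import Data.List.Properties using (length-++; length-map; filter-notAll)
  open import Data.List.Relation.Unary.All as All using (All; []; _∷_)
  open import Data.List.Relation.Unary.Any as Any using (here; there)
  open import Data.List.Relation.Unary.Unique.Propositional using (Unique; []; _∷_)
  open import Data.List.Relation.Unary.Unique.Propositional.Properties using (++⁺)
  open import Data.List.Relation.Binary.Disjoint.Propositional using (Disjoint)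
  open import Data.List.Relation.Binary.Subset.Propositional using (_⊆_)
  open import Data.List.Relation.Binary.Sublist.Propositional using (lookup; ⊆-refl)
  open import Data.List.Relation.Binary.Sublist.Heterogeneous.Properties using (take-Sublist)
  open import Data.List.Membership.Propositional using (_∈_; find; lose)
  open import Data.List.Membership.Propositional.Properties using (∈-concatMap⁺; ∈-concatMap⁻; ∈-map⁻; ∈-filter⁺)
  open import Data.Product using (∃; _×_; _,_)
  open import Function using (_∘′_)
  open import Relation.Nullary using (¬_; does; ¬?)
  open import Relation.Unary using (Pred; Decidable)
  open import Relation.Unary.Properties using (∁?)
  open import Relation.Binary.Definitions using (DecidableEquality)
  open import Relation.Binary.PropositionalEquality
  open import Level using (0ℓ)
  open import Data.Bool using (true; false)

  private variable
    A B : Set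
    xs ys : List A

  module _ {A : Set} {P : Pred A 0ℓ} (P? : Decidable P) where

    length-filter+length-filter-∁ : ∀ xs → length (filter P? xs) + length (filter (∁? P?) xs) ≡ length xs
    length-filter+length-filter-∁ [] = refl
    length-filter+length-filter-∁ (x ∷ xs) with does (P? x)
    ... | true  = cong suc (length-filter+length-filter-∁ xs)
    ... | false = trans (+-suc _ _) (cong suc (length-filter+length-filter-∁ xs))

  module _ {A : Set} (_≟_ : DecidableEquality A) where

    Unique-⊆⇒length≤ : {xs ys : List A} → Unique xs → xs ⊆ ys → length xs ≤ length ys
    Unique-⊆⇒length≤ {xs = []} _ _ = z≤n
    Unique-⊆⇒length≤ {xs = x ∷ xs} {ys} (x≢xs ∷ xs!) x∷xs⊆ys =
      ≤-trans (s≤s (Unique-⊆⇒length≤ xs! xs⊆ys∖x)) (filter-notAll (≢x? ) ys (Any.map x≡⇒¬≢x (x∷xs⊆ys (here refl))))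
      where
      ≢x? : Decidable (_≢ x)
      ≢x? y = ¬? (y ≟ x)
      x≡⇒¬≢x : ∀ {y} → x ≡ y → ¬ (y ≢ x)
      x≡⇒¬≢x refl y≢x = y≢x refl
      xs⊆ys∖x : xs ⊆ filter ≢x? ys
      xs⊆ys∖x z∈xs = ∈-filter⁺ ≢x? (x∷xs⊆ys (there z∈xs)) λ { refl → All.lookup x≢xs z∈xs refl }

  map⁺-Unique-on : (f : A → B) → (∀ {x y} → x ∈ xs → y ∈ xs → f x ≡ f y → x ≡ y) →
    Unique xs → Unique (map f xs)
  map⁺-Unique-on f f-inj [] = []
  map⁺-Unique-on f f-inj (x≢xs ∷ xs!) =
    All.tabulate fx≢ ∷ map⁺-Unique-on f (λ x∈ y∈ → f-inj (there x∈) (there y∈)) xs!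
    where
    fx≢ : ∀ {z} → z ∈ map f _ → f _ ≢ z
    fx≢ z∈ fx≡z with ∈-map⁻ f z∈
    ... | y , y∈xs , refl = All.lookup x≢xs y∈xs (f-inj (here refl) (there y∈xs) fx≡z)

  ∈-concatMap⁻′ : (f : A → List B) (xs : List A) {z : B} → z ∈ concatMap f xs → ∃ λ x → x ∈ xs × z ∈ f x
  ∈-concatMap⁻′ f xs z∈ = find (∈-concatMap⁻ f {xs = xs} z∈)

  ∈-concatMap⁺′ : (f : A → List B) {x : A} {z : B} → x ∈ xs → z ∈ f x → z ∈ concatMap f xs
  ∈-concatMap⁺′ f x∈ z∈ = ∈-concatMap⁺ f (lose x∈ z∈)

  concatMap⁺-Unique : (f : A → List B) → Unique xs → (∀ {x} → x ∈ xs → Unique (f x)) →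
    (∀ {x y} → x ∈ xs → y ∈ xs → x ≢ y → Disjoint (f x) (f y)) → Unique (concatMap f xs)
  concatMap⁺-Unique f [] _ _ = []
  concatMap⁺-Unique {xs = x ∷ xs} f (x≢xs ∷ xs!) f! f-disjoint =
    ++⁺ (f! (here refl))
        (concatMap⁺-Unique f xs! (f! ∘′ there) λ x∈ y∈ → f-disjoint (there x∈) (there y∈))
        λ (z∈fx , z∈rest) → let y , y∈xs , z∈fy = ∈-concatMap⁻′ f xs z∈rest
                            in f-disjoint (here refl) (there y∈xs) (All.lookup x≢xs y∈xs) (z∈fx , z∈fy)

  length-concatMap : (f : A → List B) {c : ℕ} → All (λ x → length (f x) ≡ c) xs →
    length (concatMap f xs) ≡ length xs * c
  length-concatMap f [] = refl
  length-concatMap {xs = x ∷ xs} f (∣fx∣≡c ∷ rest) =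
    trans (length-++ (f x)) (cong₂ _+_ ∣fx∣≡c (length-concatMap f rest))

  length-cartesianProduct : (xs : List A) (ys : List B) → length (cartesianProduct xs ys) ≡ length xs * length ys
  length-cartesianProduct [] ys = refl
  length-cartesianProduct (x ∷ xs) ys =
    trans (length-++ (map (x ,_) ys)) (cong₂ _+_ (length-map (x ,_) ys) (length-cartesianProduct xs ys))

  ∈-take⁻ : ∀ k {x : A} → x ∈ take k xs → x ∈ xs
  ∈-take⁻ k = lookup (take-Sublist k ⊆-refl)

  ∈-take-++⁺ˡ : ∀ k {x : A} → x ∈ xs → length xs ≤ k → x ∈ take k (xs ++ ys)
  ∈-take-++⁺ˡ (suc k) (here refl) _ = here refl
  ∈-take-++⁺ˡ (suc k) (there x∈xs) (s≤s ∣xs∣≤k) = there (∈-take-++⁺ˡ k x∈xs ∣xs∣≤k)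

module SubsetEnumeration where

  open import Data.Nat using (ℕ; zero; suc; _+_; z≤n; s≤s)
  open import Data.Nat.Properties using (+-comm; suc-injective)
  open import Data.Nat.Combinatorics using (_C_; nCk+nC[k+1]≡[n+1]C[k+1])
  open import Data.Nat.Combinatorics.Specification using (k>n⇒nCk≡0)
  open import Data.Fin as Fin using (Fin; zero; suc)
  import Data.Fin.Properties as Fin
  open import Data.Vec using ([]; _∷_; here; there)
  open import Data.Fin.Subset using (Subset; ∣_∣; inside; outside) renaming (_∈_ to _∈ₛ_)
  open import Data.List using (List; []; _∷_; _++_; map; length)
  open import Data.List.Properties using (length-++; length-map)
  open import Data.List.Relation.Unary.All as All using ([])
  open import Data.List.Relation.Unary.Any using (here; there)
  open import Data.List.Relation.Unary.Unique.Propositional using (Unique; []; _∷_)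
  open import Data.List.Relation.Unary.Unique.Propositional.Properties using (map⁺; ++⁺)
  open import Data.List.Membership.Propositional using (_∈_)
  open import Data.List.Relation.Binary.Disjoint.Propositional using (Disjoint)
  open import Data.List.Membership.Propositional.Properties using (∈-map⁻; ∈-map⁺; ∈-++⁻; ∈-++⁺ˡ; ∈-++⁺ʳ)
  open import Data.Product using (_,_)
  open import Data.Sum using (inj₁; inj₂)
  open import Relation.Binary.PropositionalEquality

  level : (n k : ℕ) → List (Subset n)
  level zero    zero    = [] ∷ []
  level zero    (suc k) = []
  level (suc n) zero    = map (outside ∷_) (level n zero)
  level (suc n) (suc k) = map (outside ∷_) (level n (suc k)) ++ map (inside ∷_) (level n k)

  ∷-injectiveʳ : ∀ {n b} {p q : Subset n} → b ∷ p ≡ b ∷ q → p ≡ q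
  ∷-injectiveʳ refl = refl

  level-length : ∀ n k → length (level n k) ≡ n C k
  level-length zero    zero    = refl
  level-length zero    (suc k) = sym (k>n⇒nCk≡0 {0} {suc k} (s≤s z≤n))
  level-length (suc n) zero    = trans (length-map _ (level n zero)) (level-length n zero)
  level-length (suc n) (suc k) = begin
    length (map (outside ∷_) (level n (suc k)) ++ map (inside ∷_) (level n k))
      ≡⟨ length-++ (map (outside ∷_) (level n (suc k))) ⟩
    length (map (outside ∷_) (level n (suc k))) + length (map (inside ∷_) (level n k))
      ≡⟨ cong₂ _+_ (length-map _ (level n (suc k))) (length-map _ (level n k)) ⟩
    length (level n (suc k)) + length (level n k)
      ≡⟨ cong₂ _+_ (level-length n (suc k)) (level-length n k) ⟩
    n C suc k + n C k
      ≡⟨ +-comm (n C suc k) (n C k) ⟩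
    n C k + n C suc k
      ≡⟨ nCk+nC[k+1]≡[n+1]C[k+1] n k ⟩
    suc n C suc k ∎
    where open ≡-Reasoning

  ∈-level⁺ : ∀ {n k} (p : Subset n) → ∣ p ∣ ≡ k → p ∈ level n k
  ∈-level⁺ []            refl = here refl
  ∈-level⁺ {k = zero}  (outside ∷ p) ∣p∣≡k = ∈-map⁺ _ (∈-level⁺ p ∣p∣≡k)
  ∈-level⁺ {k = suc k} (outside ∷ p) ∣p∣≡k = ∈-++⁺ˡ (∈-map⁺ _ (∈-level⁺ p ∣p∣≡k))
  ∈-level⁺ {suc n} {suc k} (inside ∷ p) ∣p∣≡k =
    ∈-++⁺ʳ (map (outside ∷_) (level n (suc k))) (∈-map⁺ _ (∈-level⁺ p (suc-injective ∣p∣≡k)))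

  ∈-level⁻ : ∀ n k {p : Subset n} → p ∈ level n k → ∣ p ∣ ≡ k
  ∈-level⁻ zero    zero    (here refl) = refl
  ∈-level⁻ (suc n) zero    p∈ with ∈-map⁻ _ p∈
  ... | _ , q∈ , refl = ∈-level⁻ n zero q∈
  ∈-level⁻ (suc n) (suc k) p∈ with ∈-++⁻ (map (outside ∷_) (level n (suc k))) p∈
  ... | inj₁ p∈ˡ with ∈-map⁻ _ p∈ˡ
  ...   | _ , q∈ , refl = ∈-level⁻ n (suc k) q∈
  ∈-level⁻ (suc n) (suc k) p∈ | inj₂ p∈ʳ with ∈-map⁻ _ p∈ʳ
  ...   | _ , q∈ , refl = cong suc (∈-level⁻ n k q∈)

  level-Unique : ∀ n k → Unique (level n k)
  level-Unique zero    zero    = [] ∷ []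
  level-Unique zero    (suc k) = []
  level-Unique (suc n) zero    = map⁺ ∷-injectiveʳ (level-Unique n zero)
  level-Unique (suc n) (suc k) =
    ++⁺ (map⁺ ∷-injectiveʳ (level-Unique n (suc k))) (map⁺ ∷-injectiveʳ (level-Unique n k)) outside≢inside
    where
    outside≢inside : Disjoint (map (outside ∷_) (level n (suc k))) (map (inside ∷_) (level n k))
    outside≢inside (p∈ˡ , p∈ʳ) with ∈-map⁻ _ p∈ˡ | ∈-map⁻ _ p∈ʳ
    ... | _ , _ , refl | _ , _ , ()

  elements : ∀ {n} → Subset n → List (Fin n)
  elements []            = []
  elements (inside  ∷ p) = zero ∷ map suc (elements p)
  elements (outside ∷ p) = map suc (elements p)

  length-elements : ∀ {n} (p : Subset n) → length (elements p) ≡ ∣ p ∣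
  length-elements []            = refl
  length-elements (inside  ∷ p) = cong suc (trans (length-map suc (elements p)) (length-elements p))
  length-elements (outside ∷ p) = trans (length-map suc (elements p)) (length-elements p)

  ∈-elements⁺ : ∀ {n} {p : Subset n} {x} → x ∈ₛ p → x ∈ elements p
  ∈-elements⁺ {p = inside  ∷ p} here       = here refl
  ∈-elements⁺ {p = inside  ∷ p} (there x∈) = there (∈-map⁺ suc (∈-elements⁺ x∈))
  ∈-elements⁺ {p = outside ∷ p} (there x∈) = ∈-map⁺ suc (∈-elements⁺ x∈)

  ∈-elements⁻ : ∀ {n} (p : Subset n) {x} → x ∈ elements p → x ∈ₛ p
  ∈-elements⁻ (inside  ∷ p) (here refl) = here
  ∈-elements⁻ (inside  ∷ p) (there x∈) with ∈-map⁻ suc x∈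
  ... | _ , y∈ , refl = there (∈-elements⁻ p y∈)
  ∈-elements⁻ (outside ∷ p) x∈ with ∈-map⁻ suc x∈
  ... | _ , y∈ , refl = there (∈-elements⁻ p y∈)

  elements-Unique : ∀ {n} (p : Subset n) → Unique (elements p)
  elements-Unique []            = []
  elements-Unique (inside  ∷ p) = All.tabulate zero∉ ∷ map⁺ Fin.suc-injective (elements-Unique p)
    where
    zero∉ : ∀ {x} → x ∈ map suc (elements p) → zero ≢ x
    zero∉ x∈ refl with ∈-map⁻ suc x∈
    ... | _ , _ , ()
  elements-Unique (outside ∷ p) = map⁺ Fin.suc-injective (elements-Unique p)

module ShadowDisjointProperties where

  open import Defs using (Family; ShadowDisjoint)
  open ListProperties using (∈-take⁻)
  open import Data.Nat using (ℕ; suc; _+_; _≤_)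
  open import Data.Nat.Properties using (≤-trans; <⇒≱)
  import Data.Bool as Bool
  open import Data.Vec.Properties using (≡-dec)
  open import Data.Fin.Subset using (Subset; ∣_∣; _⊆_; _∩_)
  open import Data.Fin.Subset.Properties using (x∈p∩q⁺; p⊆q⇒∣p∣≤∣q∣)
  open import Data.List using (take)
  import Data.List.Relation.Unary.All.Properties as All
  open import Data.List.Relation.Unary.Unique.Propositional.Properties using (take⁺)
  open import Data.List.Membership.Propositional using (_∈_)
  open import Data.Product using (_,_)
  open import Relation.Nullary using (yes; no; contradiction)
  open import Relation.Binary.PropositionalEquality using (_≡_)

  private variable
    t j : ℕ
    F : Family t

  ShadowDisjoint-take : ∀ {l} k → ShadowDisjoint t l F → ShadowDisjoint t l (take k F)
  ShadowDisjoint-take k (F-unique , F-size , F-meet) =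
    take⁺ k F-unique , All.take⁺ k F-size , λ A∈ B∈ → F-meet (∈-take⁻ k A∈) (∈-take⁻ k B∈)

  ShadowDisjoint⇒≡ : ShadowDisjoint t (2 + j) F → ∀ {A B Z} → A ∈ F → B ∈ F →
    Z ⊆ A → Z ⊆ B → suc j ≤ ∣ Z ∣ → A ≡ B
  ShadowDisjoint⇒≡ (_ , _ , F-meet) {A} {B} A∈F B∈F Z⊆A Z⊆B 1+j≤∣Z∣ with ≡-dec Bool._≟_ A B
  ... | yes A≡B = A≡B
  ... | no  A≢B = contradiction (F-meet A∈F B∈F A≢B)
        (<⇒≱ (≤-trans 1+j≤∣Z∣ (p⊆q⇒∣p∣≤∣q∣ λ x∈Z → x∈p∩q⁺ (Z⊆A x∈Z , Z⊆B x∈Z))))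

module FlatAntichains where

  open import Defs using (Family; IsMaximalAntichainLevels)
  open SubsetProperties
  open ListProperties
  open SubsetEnumeration
  open import Data.Nat using (ℕ; suc; _+_; _≤_; _≤?_)
  open import Data.Nat.Properties using (≤-reflexive; ≤-trans; ≤-antisym; ≰⇒>; +-comm; +-assoc; 1+n≰n)
  open import Function using (_∘_)
  open import Data.Nat.Combinatorics using (_C_)
  import Data.Bool as Bool
  open import Data.Vec.Properties using (≡-dec)
  open import Data.Fin.Subset using (Subset; ∣_∣; _⊆_)
  open import Data.Fin.Subset.Properties using (⊆-refl; ⊆-trans; p⊆q⇒∣p∣≤∣q∣)
  open import Data.List using (_++_; length; filter)
  open import Data.List.Properties using (length-++)
  open import Data.List.Relation.Unary.All as All using (All)
  import Data.List.Relation.Unary.All.Properties as All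
  open import Data.List.Relation.Unary.Unique.Propositional using (Unique)
  open import Data.List.Relation.Unary.Unique.Propositional.Properties using (++⁺; filter⁺)
  open import Data.List.Membership.Propositional using (_∈_; _∉_)
  open import Data.List.Membership.Propositional.Properties using (∈-++⁻; ∈-++⁺ˡ; ∈-++⁺ʳ; ∈-filter⁻; ∈-filter⁺)
  import Data.List.Membership.DecPropositional as DecMembership
  open import Data.Product using (∃; _×_; _,_; proj₁; proj₂)
  open import Data.Sum using (_⊎_; inj₁; inj₂)
  open import Relation.Nullary using (Dec; yes; no; contradiction)
  open import Relation.Unary.Properties using (∁?)
  open import Relation.Binary.PropositionalEquality

  FacetOutside : ∀ {N} → ℕ → Family N → Subset N → Set
  FacetOutside l R Y = ∃ λ Z → Z ⊆ Y × ∣ Z ∣ ≡ l × Z ∉ R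

  module FlatAntichain {N l : ℕ} (l≤N : l ≤ N) {𝒢 R : Family N}
    (𝒢-unique : Unique 𝒢) (𝒢-size : All (λ B → ∣ B ∣ ≡ suc l) 𝒢)
    (R-unique : Unique R) (R-size : All (λ Z → ∣ Z ∣ ≡ l) R)
    (∂𝒢⊆R : ∀ {A B} → B ∈ 𝒢 → A ⊆ B → ∣ A ∣ ≡ l → A ∈ R)
    (R⊆∂𝒢 : ∀ {A} → A ∈ R → ∃ λ B → B ∈ 𝒢 × A ⊆ B)
    (𝒢-or-facet : ∀ Y → ∣ Y ∣ ≡ suc l → Y ∈ 𝒢 ⊎ FacetOutside l R Y)
    where

    _≟_ : (p q : Subset N) → Dec (p ≡ q)
    _≟_ = ≡-dec Bool._≟_

    open DecMembership _≟_ using (_∈?_)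

    kept : Family N
    kept = filter (∁? (_∈? R)) (level N l)

    antichain : Family N
    antichain = kept ++ 𝒢

    ∈-kept⁺ : ∀ {A} → ∣ A ∣ ≡ l → A ∉ R → A ∈ kept
    ∈-kept⁺ {A} ∣A∣≡l A∉R = ∈-filter⁺ (∁? (_∈? R)) (∈-level⁺ A ∣A∣≡l) A∉R

    ∈-kept⁻ : ∀ {A} → A ∈ kept → ∣ A ∣ ≡ l × A ∉ R
    ∈-kept⁻ A∈ = let A∈level , A∉R = ∈-filter⁻ (∁? (_∈? R)) {xs = level N l} A∈
                 in ∈-level⁻ N l A∈level , A∉R

    ∈-𝒢⇒size : ∀ {B} → B ∈ 𝒢 → ∣ B ∣ ≡ suc l
    ∈-𝒢⇒size = All.lookup 𝒢-size

    antichain-⊆⇒≡ : ∀ {A B} → A ∈ antichain → B ∈ antichain → A ⊆ B → A ≡ B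
    antichain-⊆⇒≡ {A} {B} A∈ B∈ A⊆B = by-levels (∈-++⁻ kept A∈) (∈-++⁻ kept B∈)
      where
      equal-size : ∣ B ∣ ≡ ∣ A ∣ → A ≡ B
      equal-size ∣B∣≡∣A∣ = p⊆q∧∣q∣≤∣p∣⇒p≡q A⊆B (≤-reflexive ∣B∣≡∣A∣)
      by-levels : A ∈ kept ⊎ A ∈ 𝒢 → B ∈ kept ⊎ B ∈ 𝒢 → A ≡ B
      by-levels (inj₁ A∈k) (inj₁ B∈k) = equal-size (trans (proj₁ (∈-kept⁻ B∈k)) (sym (proj₁ (∈-kept⁻ A∈k))))
      by-levels (inj₂ A∈𝒢) (inj₂ B∈𝒢) = equal-size (trans (∈-𝒢⇒size B∈𝒢) (sym (∈-𝒢⇒size A∈𝒢)))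
      by-levels (inj₁ A∈k) (inj₂ B∈𝒢) =
        contradiction (∂𝒢⊆R B∈𝒢 A⊆B (proj₁ (∈-kept⁻ A∈k))) (proj₂ (∈-kept⁻ A∈k))
      by-levels (inj₂ A∈𝒢) (inj₁ B∈k) = contradiction
        (≤-trans (≤-reflexive (sym (∈-𝒢⇒size A∈𝒢))) (≤-trans (p⊆q⇒∣p∣≤∣q∣ A⊆B) (≤-reflexive (proj₁ (∈-kept⁻ B∈k)))))
        1+n≰n

    comparable-level : ∀ Y → ∣ Y ∣ ≡ l → ∃ λ A → A ∈ antichain × Y ⊆ A
    comparable-level Y ∣Y∣≡l with Y ∈? R
    ... | no  Y∉R = Y , ∈-++⁺ˡ (∈-kept⁺ ∣Y∣≡l Y∉R) , ⊆-refl
    ... | yes Y∈R = let B , B∈𝒢 , Y⊆B = R⊆∂𝒢 Y∈R in B , ∈-++⁺ʳ kept B∈𝒢 , Y⊆B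

    comparable-level+1 : ∀ Y → ∣ Y ∣ ≡ suc l → ∃ λ A → A ∈ antichain × A ⊆ Y
    comparable-level+1 Y ∣Y∣≡1+l with 𝒢-or-facet Y ∣Y∣≡1+l
    ... | inj₁ Y∈𝒢 = Y , ∈-++⁺ʳ kept Y∈𝒢 , ⊆-refl
    ... | inj₂ (Z , Z⊆Y , ∣Z∣≡l , Z∉R) = Z , ∈-++⁺ˡ (∈-kept⁺ ∣Z∣≡l Z∉R) , Z⊆Y

    comparable : ∀ X → ∃ λ A → A ∈ antichain × (A ⊆ X ⊎ X ⊆ A)
    comparable X with ∣ X ∣ ≤? l
    ... | yes ∣X∣≤l =
      let Y , X⊆Y , ∣Y∣≡l = ∃⊇-of-size X l ∣X∣≤l l≤N
          A , A∈ , Y⊆A = comparable-level Y ∣Y∣≡l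
      in A , A∈ , inj₂ (⊆-trans X⊆Y Y⊆A)
    ... | no ∣X∣≰l =
      let Y , Y⊆X , ∣Y∣≡1+l = ∃⊆-of-size X (suc l) (≰⇒> ∣X∣≰l)
          A , A∈ , A⊆Y = comparable-level+1 Y ∣Y∣≡1+l
      in A , A∈ , inj₁ (⊆-trans A⊆Y Y⊆X)

    antichain-isMaximal : IsMaximalAntichainLevels N l antichain
    antichain-isMaximal =
      ++⁺ (filter⁺ (∁? (_∈? R)) (level-Unique N l)) 𝒢-unique
          (λ (A∈k , A∈𝒢) → 1+n≰n (≤-reflexive (trans (sym (∈-𝒢⇒size A∈𝒢)) (proj₁ (∈-kept⁻ A∈k))))) ,
      All.++⁺ (All.tabulate (inj₁ ∘ proj₁ ∘ ∈-kept⁻))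
              (All.map (λ ∣B∣≡1+l → inj₂ (trans ∣B∣≡1+l (+-comm 1 l))) 𝒢-size) ,
      antichain-⊆⇒≡ ,
      λ X _ → comparable X

    length-filter-∈R : length (filter (_∈? R) (level N l)) ≡ length R
    length-filter-∈R = ≤-antisym
      (Unique-⊆⇒length≤ _≟_ (filter⁺ (_∈? R) (level-Unique N l))
        (λ A∈ → proj₂ (∈-filter⁻ (_∈? R) {xs = level N l} A∈)))
      (Unique-⊆⇒length≤ _≟_ R-unique
        (λ {A} A∈R → ∈-filter⁺ (_∈? R) (∈-level⁺ A (All.lookup R-size A∈R)) A∈R))

    antichain-length : length antichain + length R ≡ N C l + length 𝒢
    antichain-length = begin
      length (kept ++ 𝒢) + length R      ≡⟨ cong (_+ length R) (length-++ kept) ⟩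
      length kept + length 𝒢 + length R  ≡⟨ +-assoc (length kept) _ _ ⟩
      length kept + (length 𝒢 + length R) ≡⟨ cong (length kept +_) (+-comm (length 𝒢) _) ⟩
      length kept + (length R + length 𝒢) ≡⟨ +-assoc (length kept) _ _ ⟨
      length kept + length R + length 𝒢  ≡⟨ cong (λ r → length kept + r + length 𝒢) length-filter-∈R ⟨
      length kept + length (filter (_∈? R) (level N l)) + length 𝒢
        ≡⟨ cong (_+ length 𝒢) (+-comm (length kept) _) ⟩
      length (filter (_∈? R) (level N l)) + length kept + length 𝒢
        ≡⟨ cong (_+ length 𝒢) (length-filter+length-filter-∁ (_∈? R) (level N l)) ⟩
      length (level N l) + length 𝒢     ≡⟨ cong (_+ length 𝒢) (level-length N l) ⟩
      N C l + length 𝒢 ∎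
      where open ≡-Reasoning

module CoveringPairs where

  open import Defs using (Family)
  open ListProperties using (length-cartesianProduct; ∈-take⁻; ∈-take-++⁺ˡ)
  open import Data.Nat using (ℕ; zero; suc; _*_; _≤_; s≤s)
  open import Data.Nat.Properties using (≤-trans; ≤-reflexive; m≤n⇒m⊓n≡m)
  open import Data.Fin using (Fin; zero)
  open import Data.Fin.Subset using (Subset)
  open import Data.List using (List; []; _∷_; length; take; allFin; cartesianProduct)
  open import Data.List.Properties using (length-take; length-map; length-tabulate)
  open import Data.List.Relation.Unary.Unique.Propositional using (Unique; [])
  open import Data.List.Relation.Unary.Unique.Propositional.Properties using (take⁺; cartesianProduct⁺; allFin⁺)
  open import Data.List.Membership.Propositional using (_∈_)
  open import Data.List.Membership.Propositional.Properties using (∈-map⁺; ∈-cartesianProduct⁻)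
  open import Data.Product using (∃; _×_; _,_; proj₂)
  open import Relation.Binary.PropositionalEquality

  covering-pairs : ∀ {T} (M : ℕ) {Fs : Family T} → Unique Fs → ∀ {α} → length Fs ≤ α → α ≤ M * length Fs →
    ∃ λ (Pairs : List (Fin M × Subset T)) → Unique Pairs × length Pairs ≡ α ×
      (∀ {x A} → (x , A) ∈ Pairs → A ∈ Fs) × (∀ {A} → A ∈ Fs → ∃ λ x → (x , A) ∈ Pairs)
  covering-pairs zero    {[]}    _ {zero} _ _ = [] , [] , refl , (λ ()) , λ ()
  covering-pairs zero    {_ ∷ _} _ (s≤s _) ()
  -- The row x = zero of the product lists Fs and comes first, so s ≤ α puts it among the first α pairs.
  covering-pairs (suc M) {Fs} Fs-unique {α} s≤α α≤ =
    Pairs , take⁺ α (cartesianProduct⁺ (allFin⁺ (suc M)) Fs-unique) , length-Pairs ,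
    (λ p∈ → proj₂ (∈-cartesianProduct⁻ (allFin (suc M)) Fs (∈-take⁻ α p∈))) ,
    λ A∈ → zero , ∈-take-++⁺ˡ α (∈-map⁺ (zero ,_) A∈) (≤-trans (≤-reflexive (length-map (zero ,_) Fs)) s≤α)
    where
    Pairs : List (Fin (suc M) × Subset _)
    Pairs = take α (cartesianProduct (allFin (suc M)) Fs)
    length-Pairs : length Pairs ≡ α
    length-Pairs = trans (length-take α _) (m≤n⇒m⊓n≡m (≤-trans α≤ (≤-reflexive (sym
      (trans (length-cartesianProduct (allFin (suc M)) Fs) (cong (_* length Fs) (length-tabulate {n = suc M} (λ i → i))))))))

module Raising where

  open import Defs using (Family; ShadowDisjoint)
  open SubsetProperties
  open ListProperties
  open SubsetEnumeration using (elements; length-elements; ∈-elements⁺; ∈-elements⁻; elements-Unique)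
  open ShadowDisjointProperties using (ShadowDisjoint⇒≡)
  open FlatAntichains using (FacetOutside)
  open import Data.Nat using (ℕ; zero; suc; _+_; _*_; _≤_; z≤n; s≤s)
  open import Data.Nat.Properties using (≤-reflexive; ≤-trans; +-comm; +-identityʳ; suc-injective)
  import Data.Bool as Bool
  open import Data.Fin using (Fin)
  open import Data.Vec using (_++_; splitAt)
  open import Data.Vec.Properties using (≡-dec; ++-injectiveˡ; ++-injectiveʳ)
  open import Data.Fin.Subset using (Subset; ∣_∣; _⊆_; ⊥; ⁅_⁆; _-_) renaming (_∈_ to _∈ₛ_)
  open import Data.Fin.Subset.Properties using (⊆-refl; ⊥⊆; p─q⊆p; ∣⊥∣≡0; ∣⁅x⁆∣≡1; p─x─y≡p─y─x)
  open import Data.List using (List; map; length; concatMap) renaming (_++_ to _++ₗ_)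
  open import Data.List.Properties using (length-++; length-map)
  open import Data.List.Relation.Unary.All as All using (All)
  import Data.List.Relation.Unary.All.Properties as All
  open import Data.List.Relation.Unary.Unique.Propositional using (Unique)
  open import Data.List.Relation.Unary.Unique.Propositional.Properties using (map⁺; ++⁺)
  open import Data.List.Membership.Propositional using (_∈_)
  open import Data.List.Membership.Propositional.Properties using (∈-map⁻; ∈-map⁺; ∈-++⁻; ∈-++⁺ˡ; ∈-++⁺ʳ)
  import Data.List.Membership.DecPropositional as DecMembership
  open import Data.Product using (∃; ∃₂; _×_; _,_; proj₁; proj₂)
  open import Data.Sum using (_⊎_; inj₁; inj₂)
  open import Relation.Nullary using (yes; no; contradiction)
  open import Relation.Binary.PropositionalEquality
  open import Data.List.Relation.Binary.Disjoint.Propositional using (Disjoint)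

  module RaisedPairs {T M j : ℕ} {Fs : Family T} (Fs-disjoint : ShadowDisjoint T (2 + j) Fs)
    (Pairs : List (Fin M × Subset T)) (Pairs-unique : Unique Pairs)
    (Pairs⊆Fs : ∀ {x A} → (x , A) ∈ Pairs → A ∈ Fs)
    (Fs-covered : ∀ {A} → A ∈ Fs → ∃ λ x → (x , A) ∈ Pairs)
    where

    l : ℕ
    l = 2 + j

    Fs-size : ∀ {A} → A ∈ Fs → ∣ A ∣ ≡ l
    Fs-size = All.lookup (proj₁ (proj₂ Fs-disjoint))

    -- The ground set [T + M] is [T] followed by the M new points; a subset is written Za ++ Zb.
    raise : Fin M × Subset T → Subset (T + M)
    raise (x , A) = A ++ ⁅ x ⁆

    raised : Family (T + M)
    raised = map raise Pairs

    facets : Fin M × Subset T → Family (T + M)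
    facets (x , A) = map (λ a → (A - a) ++ ⁅ x ⁆) (elements A)

    -- Each l-subset of a raised set is listed once: A itself, or (A - a) ∪ {x} for a ∈ A.
    shadow : Family (T + M)
    shadow = map (_++ ⊥) Fs ++ₗ concatMap facets Pairs

    ∈-shadow⁺ˡ : ∀ {A} → A ∈ Fs → A ++ ⊥ ∈ shadow
    ∈-shadow⁺ˡ A∈Fs = ∈-++⁺ˡ (∈-map⁺ (_++ ⊥) A∈Fs)

    ∈-shadow⁺ʳ : ∀ {x A a} → (x , A) ∈ Pairs → a ∈ₛ A → (A - a) ++ ⁅ x ⁆ ∈ shadow
    ∈-shadow⁺ʳ p∈ a∈A = ∈-++⁺ʳ (map (_++ ⊥) Fs) (∈-concatMap⁺′ facets p∈ (∈-map⁺ _ (∈-elements⁺ a∈A)))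

    ∈-shadow⁻ : ∀ {Za : Subset T} {Zb : Subset M} → Za ++ Zb ∈ shadow →
      (Za ∈ Fs × Zb ≡ ⊥) ⊎ (∃₂ λ x A → (x , A) ∈ Pairs × Zb ≡ ⁅ x ⁆ × ∃ λ a → a ∈ₛ A × Za ≡ A - a)
    ∈-shadow⁻ {Za} Z∈ with ∈-++⁻ (map (_++ ⊥) Fs) Z∈
    ... | inj₁ Z∈ˡ with ∈-map⁻ (_++ ⊥) Z∈ˡ
    ...   | A , A∈Fs , Z≡ = inj₁ (subst (_∈ Fs) (sym (++-injectiveˡ Za A Z≡)) A∈Fs , ++-injectiveʳ Za A Z≡)
    ∈-shadow⁻ {Za} Z∈ | inj₂ Z∈ʳ with ∈-concatMap⁻′ facets Pairs Z∈ʳ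
    ... | (x , A) , p∈ , Z∈facets with ∈-map⁻ _ Z∈facets
    ...   | a , a∈ , Z≡ = inj₂ (x , A , p∈ , ++-injectiveʳ Za (A - a) Z≡ , a , ∈-elements⁻ A a∈ , ++-injectiveˡ Za (A - a) Z≡)

    ∈-shadow⇒∣b∣≤1 : (Za : Subset T) (Zb : Subset M) → Za ++ Zb ∈ shadow → ∣ Zb ∣ ≤ 1
    ∈-shadow⇒∣b∣≤1 Za Zb Z∈ with ∈-shadow⁻ {Za} {Zb} Z∈
    ... | inj₁ (_ , refl) = ≤-trans (≤-reflexive (∣⊥∣≡0 M)) z≤n
    ... | inj₂ (x , _ , _ , refl , _) = ≤-reflexive (∣⁅x⁆∣≡1 x)

    ∈-shadow⇒∈Fs : ∀ {Za : Subset T} → Za ++ ⊥ ∈ shadow → Za ∈ Fs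
    ∈-shadow⇒∈Fs {Za} Z∈ with ∈-shadow⁻ {Za} {⊥} Z∈
    ... | inj₁ (Za∈Fs , _) = Za∈Fs
    ... | inj₂ (_ , _ , _ , ⊥≡⁅x⁆ , _) = contradiction ⊥≡⁅x⁆ ⊥≢⁅x⁆

    ∈-shadow⇒size : ∀ {Z} → Z ∈ shadow → ∣ Z ∣ ≡ l
    ∈-shadow⇒size {Z} Z∈ with splitAt T Z
    ... | Za , Zb , refl with ∈-shadow⁻ {Za} {Zb} Z∈
    ...   | inj₁ (Za∈Fs , refl) = trans (∣p++⊥∣≡∣p∣ Za) (Fs-size Za∈Fs)
    ...   | inj₂ (x , A , p∈ , refl , a , a∈A , refl) =
      trans (∣p++⁅x⁆∣≡1+∣p∣ (A - a) x) (trans (x∈p⇒suc∣p-x∣≡∣p∣ a∈A) (Fs-size (Pairs⊆Fs p∈)))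

    ∈-shadow⇒⊆raised : ∀ {Z} → Z ∈ shadow → ∃ λ B → B ∈ raised × Z ⊆ B
    ∈-shadow⇒⊆raised {Z} Z∈ with splitAt T Z
    ... | Za , Zb , refl with ∈-shadow⁻ {Za} {Zb} Z∈
    ...   | inj₁ (Za∈Fs , refl) =
      let x , p∈ = Fs-covered Za∈Fs in Za ++ ⁅ x ⁆ , ∈-map⁺ raise p∈ , ++⁺-⊆ {p = Za} ⊆-refl ⊥⊆
    ...   | inj₂ (x , A , p∈ , refl , a , _ , refl) =
      A ++ ⁅ x ⁆ , ∈-map⁺ raise p∈ , ++⁺-⊆ (p─q⊆p A _) ⊆-refl

    ⊆raised⇒∈shadow : ∀ {A B} → B ∈ raised → A ⊆ B → ∣ A ∣ ≡ l → A ∈ shadow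
    ⊆raised⇒∈shadow {A} B∈ A⊆B ∣A∣≡l with ∈-map⁻ raise B∈ | splitAt T A
    ... | (x , C) , p∈ , refl | Aa , Ab , refl with ++⁻-⊆ {p = Aa} A⊆B
    ...   | Aa⊆C , Ab⊆⁅x⁆ with p⊆⁅x⁆⇒p≡⊥⊎p≡⁅x⁆ Ab⊆⁅x⁆
    ...     | inj₁ refl = subst (λ D → D ++ ⊥ ∈ shadow) (sym Aa≡C) (∈-shadow⁺ˡ (Pairs⊆Fs p∈))
      where
      Aa≡C : Aa ≡ C
      Aa≡C = p⊆q∧∣q∣≤∣p∣⇒p≡q Aa⊆C (≤-reflexive (trans (Fs-size (Pairs⊆Fs p∈)) (trans (sym ∣A∣≡l) (∣p++⊥∣≡∣p∣ Aa))))
    ...     | inj₂ refl with p⊆q∧suc∣p∣≡∣q∣⇒p≡q-x Aa⊆C (trans (sym (∣p++⁅x⁆∣≡1+∣p∣ Aa x)) (trans ∣A∣≡l (sym (Fs-size (Pairs⊆Fs p∈)))))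
    ...       | a , a∈C , refl = ∈-shadow⁺ʳ p∈ a∈C

    raise-injective : ∀ {p q} → raise p ≡ raise q → p ≡ q
    raise-injective {x , A} {y , B} A⁅x⁆≡B⁅y⁆ =
      cong₂ _,_ (⁅⁆-injective (++-injectiveʳ A B A⁅x⁆≡B⁅y⁆)) (++-injectiveˡ A B A⁅x⁆≡B⁅y⁆)

    raised-unique : Unique raised
    raised-unique = map⁺ raise-injective Pairs-unique

    raised-size : All (λ B → ∣ B ∣ ≡ suc l) raised
    raised-size = All.map⁺ (All.tabulate λ { {x , A} p∈ →
      trans (∣p++⁅x⁆∣≡1+∣p∣ A x) (cong suc (Fs-size (Pairs⊆Fs p∈))) })

    facets-unique : ∀ {p} → p ∈ Pairs → Unique (facets p)
    facets-unique {x , A} _ = map⁺-Unique-on _ (λ a∈ _ e → p-x≡p-y⇒x≡y (∈-elements⁻ A a∈) (++-injectiveˡ _ _ e))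
      (elements-Unique A)

    facets-disjoint : ∀ {p q} → p ∈ Pairs → q ∈ Pairs → p ≢ q → Disjoint (facets p) (facets q)
    facets-disjoint {x , A} {y , B} p∈ q∈ p≢q (Z∈p , Z∈q) with ∈-map⁻ _ Z∈p | ∈-map⁻ _ Z∈q
    ... | a , a∈A , refl | b , b∈B , Z≡ with ⁅⁆-injective (++-injectiveʳ (A - a) (B - b) Z≡)
    ...   | refl = p≢q (cong (x ,_) (ShadowDisjoint⇒≡ Fs-disjoint (Pairs⊆Fs p∈) (Pairs⊆Fs q∈)
                     (p─q⊆p A _) (subst (_⊆ B) (sym A-a≡B-b) (p─q⊆p B _))
                     (≤-reflexive (sym (x∈p∧∣p∣≡1+k⇒∣p-x∣≡k (∈-elements⁻ A a∈A) (Fs-size (Pairs⊆Fs p∈)))))))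
      where
      A-a≡B-b : A - a ≡ B - b
      A-a≡B-b = ++-injectiveˡ (A - a) (B - b) Z≡

    embedded-disjoint-facets : Disjoint (map (_++ ⊥) Fs) (concatMap facets Pairs)
    embedded-disjoint-facets (Z∈ˡ , Z∈ʳ) with ∈-map⁻ (_++ ⊥) Z∈ˡ | ∈-concatMap⁻′ facets Pairs Z∈ʳ
    ... | A , _ , refl | (x , B) , _ , Z∈facets with ∈-map⁻ _ Z∈facets
    ...   | b , _ , A⊥≡ = ⊥≢⁅x⁆ (++-injectiveʳ A (B - b) A⊥≡)

    shadow-size : All (λ Z → ∣ Z ∣ ≡ l) shadow
    shadow-size = All.tabulate ∈-shadow⇒size

    shadow-unique : Unique shadow
    shadow-unique = ++⁺ (map⁺ (++-injectiveˡ _ _) (proj₁ Fs-disjoint))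
      (concatMap⁺-Unique facets Pairs-unique facets-unique facets-disjoint) embedded-disjoint-facets

    shadow-length : length shadow ≡ length Fs + length Pairs * l
    shadow-length = trans (length-++ (map (_++ ⊥) Fs))
      (cong₂ _+_ (length-map (_++ ⊥) Fs) (length-concatMap facets (All.tabulate length-facets)))
      where
      length-facets : ∀ {p} → p ∈ Pairs → length (facets p) ≡ l
      length-facets {x , A} p∈ = trans (length-map _ (elements A)) (trans (length-elements A) (Fs-size (Pairs⊆Fs p∈)))

    open DecMembership (≡-dec {n = T + M} Bool._≟_) using (_∈?_)

    facet-or-∈ : ∀ {Y} (Z : Subset (T + M)) → Z ⊆ Y → ∣ Z ∣ ≡ l → FacetOutside l shadow Y ⊎ Z ∈ shadow
    facet-or-∈ Z Z⊆Y ∣Z∣≡l with Z ∈? shadow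
    ... | yes Z∈ = inj₂ Z∈
    ... | no  Z∉ = inj₁ (Z , Z⊆Y , ∣Z∣≡l , Z∉)

    -- Two facets of Ya both in Fs would share l - 1 points.
    facet-of-⊥ : (Ya : Subset T) → ∣ Ya ∣ ≡ suc l → FacetOutside l shadow (Ya ++ ⊥)
    facet-of-⊥ Ya ∣Ya∣≡1+l with ∣p∣≡1+k⇒Nonempty ∣Ya∣≡1+l
    ... | a₁ , a₁∈Ya with ∣p∣≡1+k⇒Nonempty (x∈p∧∣p∣≡1+k⇒∣p-x∣≡k a₁∈Ya ∣Ya∣≡1+l)
    ...   | a₂ , a₂∈Ya-a₁ = resolve (facet-or-∈ _ (remove a₁) (remove-size a₁∈Ya))
                                    (facet-or-∈ _ (remove a₂) (remove-size (p─q⊆p Ya _ a₂∈Ya-a₁)))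
      where
      remove : ∀ a → (Ya - a) ++ ⊥ ⊆ Ya ++ ⊥
      remove a = ++⁺-⊆ (p─q⊆p Ya _) ⊆-refl
      remove-size : ∀ {a} → a ∈ₛ Ya → ∣ (Ya - a) ++ ⊥ {M} ∣ ≡ l
      remove-size {a} a∈Ya = trans (∣p++⊥∣≡∣p∣ (Ya - a)) (x∈p∧∣p∣≡1+k⇒∣p-x∣≡k a∈Ya ∣Ya∣≡1+l)
      resolve : FacetOutside l shadow (Ya ++ ⊥) ⊎ (Ya - a₁) ++ ⊥ ∈ shadow →
                FacetOutside l shadow (Ya ++ ⊥) ⊎ (Ya - a₂) ++ ⊥ ∈ shadow →
                FacetOutside l shadow (Ya ++ ⊥)
      resolve (inj₁ facet) _ = facet
      resolve (inj₂ _) (inj₁ facet) = facet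
      resolve (inj₂ Z₁∈) (inj₂ Z₂∈) = contradiction (subst (a₂ ∈ₛ_) Ya-a₁≡Ya-a₂ a₂∈Ya-a₁) (x∉p-x Ya a₂)
        where
        Ya-a₁≡Ya-a₂ : Ya - a₁ ≡ Ya - a₂
        Ya-a₁≡Ya-a₂ = ShadowDisjoint⇒≡ Fs-disjoint (∈-shadow⇒∈Fs Z₁∈) (∈-shadow⇒∈Fs Z₂∈)
          (p─q⊆p (Ya - a₁) _) (subst (_⊆ Ya - a₂) (p─x─y≡p─y─x Ya a₂ a₁) (p─q⊆p (Ya - a₂) _))
          (≤-reflexive (sym (x∈p∧∣p∣≡1+k⇒∣p-x∣≡k a₂∈Ya-a₁ (x∈p∧∣p∣≡1+k⇒∣p-x∣≡k a₁∈Ya ∣Ya∣≡1+l))))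

    -- If Ya and a facet (Ya - a) ∪ {x} are both in the shadow, then Ya ∈ Fs, and the facet comes
    -- from a pair (x, A) with A ⊇ Ya - a; shadow-disjointness forces A = Ya.
    raised-or-facet-of-⁅x⁆ : (Ya : Subset T) (x : Fin M) → ∣ Ya ∣ ≡ l →
      Ya ++ ⁅ x ⁆ ∈ raised ⊎ FacetOutside l shadow (Ya ++ ⁅ x ⁆)
    raised-or-facet-of-⁅x⁆ Ya x ∣Ya∣≡l with facet-or-∈ (Ya ++ ⊥) (++⁺-⊆ {p = Ya} ⊆-refl ⊥⊆) (trans (∣p++⊥∣≡∣p∣ Ya) ∣Ya∣≡l)
    ... | inj₁ facet = inj₂ facet
    ... | inj₂ Ya⊥∈ with ∣p∣≡1+k⇒Nonempty {p = Ya} ∣Ya∣≡l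
    ...   | a , a∈Ya with facet-or-∈ ((Ya - a) ++ ⁅ x ⁆) (++⁺-⊆ (p─q⊆p Ya _) ⊆-refl)
                          (trans (∣p++⁅x⁆∣≡1+∣p∣ (Ya - a) x) (trans (x∈p⇒suc∣p-x∣≡∣p∣ a∈Ya) ∣Ya∣≡l))
    ...     | inj₁ facet = inj₂ facet
    ...     | inj₂ Z∈ with ∈-shadow⁻ {Ya - a} {⁅ x ⁆} Z∈
    ...       | inj₁ (_ , ⁅x⁆≡⊥) = contradiction (sym ⁅x⁆≡⊥) ⊥≢⁅x⁆
    ...       | inj₂ (y , A , p∈ , ⁅x⁆≡⁅y⁆ , b , _ , Ya-a≡A-b) with ⁅⁆-injective ⁅x⁆≡⁅y⁆
    ...         | refl = inj₁ (subst (λ D → D ++ ⁅ x ⁆ ∈ raised) (sym Ya≡A) (∈-map⁺ raise p∈))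
      where
      Ya≡A : Ya ≡ A
      Ya≡A = ShadowDisjoint⇒≡ Fs-disjoint (∈-shadow⇒∈Fs Ya⊥∈) (Pairs⊆Fs p∈)
        (p─q⊆p Ya _) (subst (_⊆ A) (sym Ya-a≡A-b) (p─q⊆p A _))
        (≤-reflexive (sym (x∈p∧∣p∣≡1+k⇒∣p-x∣≡k a∈Ya ∣Ya∣≡l)))

    facet-of-large : (Ya : Subset T) (Yb : Subset M) {k : ℕ} → ∣ Yb ∣ ≡ suc (suc k) → ∣ Ya ∣ + ∣ Yb ∣ ≡ suc l →
      FacetOutside l shadow (Ya ++ Yb)
    facet-of-large Ya Yb ∣Yb∣≡2+k ∣Ya∣+∣Yb∣≡1+l with ∣ Ya ∣ in ∣Ya∣≡
    ... | suc _ with ∣p∣≡1+k⇒Nonempty {p = Ya} ∣Ya∣≡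
    ...   | a , a∈Ya = (Ya - a) ++ Yb , ++⁺-⊆ (p─q⊆p Ya _) ⊆-refl ,
            trans (∣p++q∣≡∣p∣+∣q∣ (Ya - a) Yb)
                  (suc-injective (trans (cong (_+ ∣ Yb ∣) (trans (x∈p⇒suc∣p-x∣≡∣p∣ a∈Ya) ∣Ya∣≡)) ∣Ya∣+∣Yb∣≡1+l)) ,
            λ Z∈ → contradiction (≤-trans (≤-reflexive (sym ∣Yb∣≡2+k)) (∈-shadow⇒∣b∣≤1 (Ya - a) Yb Z∈)) λ { (s≤s ()) }
    facet-of-large Ya Yb _ ∣Ya∣+∣Yb∣≡1+l | zero with ∣p∣≡1+k⇒Nonempty {p = Yb} ∣Ya∣+∣Yb∣≡1+l
    ...   | b , b∈Yb = Ya ++ (Yb - b) , ++⁺-⊆ ⊆-refl (p─q⊆p Yb _) ,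
            trans (∣p++q∣≡∣p∣+∣q∣ Ya (Yb - b)) (cong₂ _+_ ∣Ya∣≡ ∣Yb-b∣≡l) ,
            λ Z∈ → contradiction (≤-trans (≤-reflexive (sym ∣Yb-b∣≡l)) (∈-shadow⇒∣b∣≤1 Ya (Yb - b) Z∈)) λ { (s≤s ()) }
      where
      ∣Yb-b∣≡l : ∣ Yb - b ∣ ≡ l
      ∣Yb-b∣≡l = x∈p∧∣p∣≡1+k⇒∣p-x∣≡k b∈Yb ∣Ya∣+∣Yb∣≡1+l

    raised-or-facet : ∀ Y → ∣ Y ∣ ≡ suc l → Y ∈ raised ⊎ FacetOutside l shadow Y
    raised-or-facet Y ∣Y∣≡1+l with splitAt T Y
    ... | Ya , Yb , refl = by-∣Yb∣ (trans (sym (∣p++q∣≡∣p∣+∣q∣ Ya Yb)) ∣Y∣≡1+l)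
      where
      by-∣Yb∣ : ∣ Ya ∣ + ∣ Yb ∣ ≡ suc l → Ya ++ Yb ∈ raised ⊎ FacetOutside l shadow (Ya ++ Yb)
      by-∣Yb∣ ∣Ya∣+∣Yb∣≡1+l with ∣ Yb ∣ in ∣Yb∣≡
      ... | 0 with ∣p∣≡0⇒p≡⊥ {p = Yb} ∣Yb∣≡
      ...   | refl = inj₂ (facet-of-⊥ Ya (trans (sym (+-identityʳ _)) ∣Ya∣+∣Yb∣≡1+l))
      by-∣Yb∣ ∣Ya∣+∣Yb∣≡1+l | 1 with ∣p∣≡1⇒p≡⁅x⁆ {p = Yb} ∣Yb∣≡
      ...   | x , refl = raised-or-facet-of-⁅x⁆ Ya x (suc-injective (trans (+-comm 1 _) ∣Ya∣+∣Yb∣≡1+l))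
      by-∣Yb∣ ∣Ya∣+∣Yb∣≡1+l | suc (suc k) =
        inj₂ (facet-of-large Ya Yb ∣Yb∣≡ (trans (cong (∣ Ya ∣ +_) ∣Yb∣≡) ∣Ya∣+∣Yb∣≡1+l))

open import Defs
open ShadowDisjointProperties using (ShadowDisjoint-take)
open CoveringPairs using (covering-pairs)
open FlatAntichains using (module FlatAntichain)
open Raising using (module RaisedPairs)
open import Data.Nat using (ℕ; suc; _≤_; _<_; _*_; _∸_; _+_; z≤n; s≤s)
open import Data.Nat.Properties using (≤-trans; <⇒≤; m≤m+n; m+[n∸m]≡n; m≤n⇒m⊓n≡m)
open import Data.Nat.Combinatorics using (_C_)
open import Data.Integer as ℤ using (ℤ; +_; _-_)
import Data.Integer.Properties as ℤ
open import Data.Integer.Tactic.RingSolver using (solve-∀)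
open import Data.List using (length; take)
open import Data.List.Properties using (length-take; length-map)
import Data.List.Relation.Unary.All as All
open import Data.Product using (∃; _×_; _,_; proj₁)
open import Relation.Binary.PropositionalEquality

count⇒ℤ : ∀ {a c s α l : ℕ} → a + (s + α * l) ≡ c + α → + a ≡ (+ c - + s) - + α ℤ.* (+ l - + 1)
count⇒ℤ {a} {c} {s} {α} {l} a+[s+αl]≡c+α = begin
  + a
    ≡⟨ unfold (+ a) (+ s) (+ α) (+ l) ⟩
  ((+ a ℤ.+ (+ s ℤ.+ + α ℤ.* + l) - + α) - + s) - + α ℤ.* (+ l - + 1)
    ≡⟨ cong (λ x → ((x - + α) - + s) - + α ℤ.* (+ l - + 1)) lifted ⟩
  ((+ c ℤ.+ + α - + α) - + s) - + α ℤ.* (+ l - + 1)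
    ≡⟨ cong (λ x → (x - + s) - + α ℤ.* (+ l - + 1)) (cancel (+ c) (+ α)) ⟩
  (+ c - + s) - + α ℤ.* (+ l - + 1) ∎
  where
  open ≡-Reasoning
  unfold : ∀ a s α l → a ≡ ((a ℤ.+ (s ℤ.+ α ℤ.* l) - α) - s) - α ℤ.* (l - + 1)
  unfold = solve-∀
  cancel : ∀ c α → c ℤ.+ α - α ≡ c
  cancel = solve-∀
  lifted : + a ℤ.+ (+ s ℤ.+ + α ℤ.* + l) ≡ + c ℤ.+ + α
  lifted = begin
    + a ℤ.+ (+ s ℤ.+ + α ℤ.* + l) ≡⟨ cong (λ x → + a ℤ.+ (+ s ℤ.+ x)) (ℤ.pos-* α l) ⟨
    + a ℤ.+ (+ s ℤ.+ + (α * l))   ≡⟨ cong (λ x → + a ℤ.+ x) (ℤ.pos-+ s (α * l)) ⟨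
    + a ℤ.+ + (s + α * l)         ≡⟨ ℤ.pos-+ a (s + α * l) ⟨
    + (a + (s + α * l))           ≡⟨ cong +_ a+[s+αl]≡c+α ⟩
    + (c + α)                     ≡⟨ ℤ.pos-+ c α ⟩
    + c ℤ.+ + α                   ∎

InS-of-ShadowDisjoint : ∀ {T M j s α} {Fs : Family T} → ShadowDisjoint T (2 + j) Fs → length Fs ≡ s →
  2 + j ≤ T + M → s ≤ α → α ≤ M * s →
  InS (T + M) (2 + j) ((+ ((T + M) C (2 + j)) - + s) - + α ℤ.* (+ (2 + j) - + 1))
InS-of-ShadowDisjoint {T} {M} {Fs = Fs} Fs-disjoint refl l≤T+M s≤α α≤Ms
  with covering-pairs M (proj₁ Fs-disjoint) s≤α α≤Ms
... | Pairs , Pairs-unique , refl , Pairs⊆Fs , Fs-covered =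
  antichain , antichain-isMaximal , count⇒ℤ {c = (T + M) C l} (begin
    length antichain + (length Fs + length Pairs * l) ≡⟨ cong (λ r → length antichain + r) shadow-length ⟨
    length antichain + length shadow                  ≡⟨ antichain-length ⟩
    (T + M) C l + length raised                       ≡⟨ cong (λ r → (T + M) C l + r) (length-map raise Pairs) ⟩
    (T + M) C l + length Pairs                        ∎)
  where
  open ≡-Reasoning
  open RaisedPairs Fs-disjoint Pairs Pairs-unique Pairs⊆Fs Fs-covered
  open FlatAntichain l≤T+M raised-unique raised-size shadow-unique shadow-size
    ⊆raised⇒∈shadow ∈-shadow⇒⊆raised raised-or-facet

lemma4p2 : (n t l s α : ℕ) → 2 ≤ l → l < t → t < n →
    (∃ λ φ → IsPhi t l φ × s ≤ φ) → s ≤ α → α ≤ (n ∸ t) * s →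
    InS n l ((+ (n C l) - + s) - (+ α) ℤ.* (+ l - + 1))
lemma4p2 n t (suc (suc j)) s α (s≤s (s≤s z≤n)) l<t t<n (_ , ((F , F-disjoint , refl) , _) , s≤∣F∣) s≤α α≤ =
  subst (λ N → InS N l ((+ (N C l) - + s) - + α ℤ.* (+ l - + 1))) (m+[n∸m]≡n (<⇒≤ t<n))
    (InS-of-ShadowDisjoint (ShadowDisjoint-take s F-disjoint) (trans (length-take s F) (m≤n⇒m⊓n≡m s≤∣F∣))
      (≤-trans (<⇒≤ l<t) (m≤m+n t _)) s≤α α≤)
  where
  l : ℕ
  l = 2 + j
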